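{- (a) Assume Conjecture A (stated in the context). Then for each $b\in\{3,4\}$ and every positive integer $t$ there exists a positive integer $n$ with $\nu_b^*(n)\geq t$; that is, there are integers of arbitrarily large persistence for $S_3^*$ and for $S_4^*$. (b) Assume Conjecture B (stated in the context). Then for every integer $b\geq 5$ and every positive integer $t$ there exists a positive integer $n$ with $\nu_b^*(n)\geq t$.
   Context: Fix an integer base $b\geq 2$. Every nonnegative integer $n$ has a base-$b$ expansion $n=\sum_{i=0}^k d_ib^i$ with $0\le d_i\le b-1$ and $d_k>0$. The Erdős–Sloane map is $S_b^*(n)=\prod_{0\le i\le k,\ d_i\neq 0} d_i$ (the product of the nonzero base-$b$ digits of $n$). For a map $f:\mathbb{N}\to\mathbb{N}$, $f^0(n)=n$ and $f^k(n)=f(f^{k-1}(n))$. The persistence $\nu_b^*(n)$ is the smallest $k\ge 0$ such that $f^k(n)$ is a periodic point of $f=S_b^*$ (i.e. the number of iterations needed to reach a fixed point or cycle); the periodic points of $S_b^*$ are exactly the fixed points $1,\dots,b-1$. For a base $q$, a digit $d\in\{0,\dots,q-1\}$ and a positive integer $n$, $\#d(n)_q$ is the number of occurrences of $d$ in the base-$q$ expansion of $n$ and $\#(n)_q$ is the number of base-$q$ digits of $n$. Given $\varepsilon>0$, $n$ is $\varepsilon$-equidistributed in base $q$ if $\left|\frac{\#d(n)_q}{\#(n)_q}-\frac1q\right|<\varepsilon$ for every $d\in\{0,\dots,q-1\}$. Conjecture A: For every integer $q>1$, every finite set $F$ of primes that does not contain all primes dividing $q$, and every positive integer $a$, if $(N_i)_{i\ge0}$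 is a sequence with $N_0=a$ and $N_{k+1}=N_k p_k$ with $p_k\in F$ for all $k\ge 0$, then for every $\varepsilon>0$ there is $n_0$ such that $N_n$ is $\varepsilon$-equidistributed in base $q$ for all $n\ge n_0$. Conjecture B: For every integer $q>1$, every finite set $F=\{p_1,\dots,p_k\}$ of primes that does not contain all primes dividing $q$, and every positive integer $a$, for every $\varepsilon>0$ there exists $N$ such that $a\prod_{i=1}^k p_i^{\alpha_i}$ (with nonnegative integers $\alpha_i$) is $\varepsilon$-equidistributed in base $q$ whenever $\alpha_i\ge N$ for some $i\in\{1,\dots,k\}$. -}

module Defs where

open import Data.Nat using (ℕ; zero; suc; _+_; _*_; _^_; _≤_; _<_; NonZero)
open import Data.Nat.DivMod using (_/_; _%_)
open import Data.Nat.Divisibility using (_∣_)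
open import Data.Nat.Primality using (Prime)
open import Data.Nat.Properties using (_≟_)
open import Data.Integer using (+_)
open import Data.Rational as ℚ using (ℚ)
open import Data.Fin using (Fin; toℕ)
open import Data.List using (List; []; _∷_; length; product)
open import Data.List.Relation.Unary.All using (All)
open import Data.List.Relation.Unary.Unique.Propositional using (Unique)
open import Data.List.Membership.Propositional using (_∈_; _∉_)
open import Data.Product using (Σ; ∃; ∃-syntax; _×_)
open import Relation.Nullary using (¬_; yes; no)
open import Function using (_∘_)

-- base-b digits (little-endian) of n; fuel argument bounds the recursion
-- (fuel n suffices since n / b < n for b ≥ 2, n > 0).
digitsAux : (b : ℕ) → .{{NonZero b}} → ℕ → ℕ → List ℕ
digitsAux b zero    n       = []
digitsAux b (suc f) zero    = []
digitsAux b (suc f) (suc m) = (suc m % b) ∷ digitsAux b f (suc m / b)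

-- base-b expansion of n (least significant digit first); 0 has the empty
-- expansion. Meaningful for b ≥ 2 only (degenerate bases give []).
digits : ℕ → ℕ → List ℕ
digits (suc (suc c)) n = digitsAux (suc (suc c)) n n
digits _             n = []

prodNonzero : List ℕ → ℕ
prodNonzero []            = 1
prodNonzero (zero  ∷ ds)  = prodNonzero ds
prodNonzero (suc d ∷ ds)  = suc d * prodNonzero ds

S* : ℕ → ℕ → ℕ
S* b n = prodNonzero (digits b n)

iter : (ℕ → ℕ) → ℕ → ℕ → ℕ
iter f zero    x = x
iter f (suc k) x = f (iter f k x)

Periodic : (ℕ → ℕ) → ℕ → Set
Periodic f x = ∃[ m ] (1 ≤ m × iter f m x ≡ x)
  where open import Relation.Binary.PropositionalEquality using (_≡_)

-- ν_b^*(n) = k : k is the least number of iterations reaching a periodic point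
PersistenceIs : ℕ → ℕ → ℕ → Set
PersistenceIs b n k =
  Periodic (S* b) (iter (S* b) k n) × (∀ j → j < k → ¬ Periodic (S* b) (iter (S* b) j n))

countOcc : ℕ → List ℕ → ℕ
countOcc d [] = 0
countOcc d (x ∷ xs) with d ≟ x
... | yes _ = suc (countOcc d xs)
... | no  _ = countOcc d xs

frac : ℕ → ℕ → ℚ
frac a zero    = ℚ.0ℚ
frac a (suc l) = (+ a) ℚ./ suc l

#d : ℕ → ℕ → ℕ → ℕ
#d d q n = countOcc d (digits q n)

#dig : ℕ → ℕ → ℕ
#dig q n = length (digits q n)

Equidistributed : ℕ → ℚ → ℕ → Set
Equidistributed q ε n =
  (d : Fin q) → ℚ.∣ frac (#d (toℕ d) q n) (#dig q n) ℚ.- frac 1 q ∣ ℚ.< ε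

MissesPrimeOf : ℕ → List ℕ → Set
MissesPrimeOf q F = ∃[ p ] (Prime p × p ∣ q × p ∉ F)

ConjectureA : Set
ConjectureA =
  (q : ℕ) → 1 < q → (F : List ℕ) → All Prime F → MissesPrimeOf q F →
  (a : ℕ) → 1 ≤ a → (N : ℕ → ℕ) → N 0 ≡ a →
  (∀ k → ∃[ p ] (p ∈ F × N (suc k) ≡ N k * p)) →
  (ε : ℚ) → ℚ.0ℚ ℚ.< ε →
  ∃[ n₀ ] (∀ n → n₀ ≤ n → Equidistributed q ε (N n))
  where open import Relation.Binary.PropositionalEquality using (_≡_)

prodPow : (F : List ℕ) → (Fin (length F) → ℕ) → ℕ
prodPow []      α = 1
prodPow (p ∷ F) α = p ^ α Fin.zero * prodPow F (α ∘ Fin.suc)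
  where import Data.Fin as Fin

ConjectureB : Set
ConjectureB =
  (q : ℕ) → 1 < q → (F : List ℕ) → Unique F → All Prime F → MissesPrimeOf q F →
  (a : ℕ) → 1 ≤ a → (ε : ℚ) → ℚ.0ℚ ℚ.< ε →
  ∃[ N ] ((α : Fin (length F) → ℕ) → (∃[ i ] (N ≤ α i)) →
          Equidistributed q ε (a * prodPow F α))

ArbitrarilyLargePersistence : ℕ → Set
ArbitrarilyLargePersistence b =
  (t : ℕ) → 1 ≤ t → ∃[ n ] ∃[ k ] (1 ≤ n × PersistenceIs b n k × t ≤ k)

{-# OPTIONS --safe #-}
module Submission where

-- Fix b = c + 2 ≥ 3 and a prime s dividing b − 1, so s is a nonzero digit not dividing b.
-- Call x a K-member if x = b^m · a · ∏_{p ∈ F_r} p^(α_p) with r a prime divisor of b, F_r the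
-- primes below b other than r, 1 ≤ a ≤ b, and some α_p ≥ K. Since F_r misses the prime r ∣ b,
-- the conjecture makes a · ∏ p^(α_p) equidistributed in base b once some exponent is large, so
-- it has many digits s and S*_b(x) is divisible by a large power of s. The prime factors of
-- S*_b(x) are digits, so S*_b(x) is again a member, now with a large exponent of s. Hence for
-- every t the first t iterates of a sufficiently deep member stay ≥ b, i.e. its persistence is
-- at least t. For b = 3 and b = 4 the sets F_r are {2} and {3}, and Conjecture A along the
-- geometric sequence a · p^k suffices.

open import Defs
open import Data.Nat
open import Data.Nat.Properties
open import Data.Nat.DivMod
open import Data.Nat.Divisibility
open import Data.Nat.GCD
open import Data.Nat.Coprimality using (coprime-/gcd)
open import Data.Nat.Primality
open import Data.Nat.Primality.Factorisation using (factorise; PrimeFactorisation)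
open import Data.Nat.ListAction using (product)
open import Data.Nat.ListAction.Properties using (∈⇒∣product)
open import Data.Nat.Induction using (<-wellFounded)
open import Data.Nat.Tactic.RingSolver using (solve-∀)
open import Induction.WellFounded using (Acc; acc)
open import Data.Integer as ℤ using (+_; +<+)
import Data.Integer.Properties as ℤP
open import Data.Rational as ℚ using (ℚ)
import Data.Rational.Properties as ℚP
open import Data.Rational.Unnormalised as ℚᵘ using (mkℚᵘ; *<*)
import Data.Rational.Unnormalised.Properties as ℚᵘP
import Algebra.Properties.AbelianGroup
open import Data.List using (List; []; _∷_; length; filter; upTo; lookup)
open import Data.List.Properties using (length-filter; length-upTo)
open import Data.List.Relation.Unary.All as All using (All; []; _∷_)
open import Data.List.Relation.Unary.Any using (here; there; index)
open import Data.List.Relation.Unary.Any.Properties using (lookup-index)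
open import Data.List.Membership.Propositional using (_∈_; _∉_)
open import Data.List.Membership.Propositional.Properties using (∈-filter⁺; ∈-filter⁻; ∈-upTo⁺; ∈-upTo⁻)
open import Data.List.Relation.Unary.Unique.Propositional using (Unique)
open import Data.List.Relation.Unary.Unique.Propositional.Properties using (filter⁺; upTo⁺)
open import Data.Fin using (Fin; zero; suc; fromℕ<)
open import Data.Fin.Properties using (any?; toℕ-fromℕ<)
open import Data.Vec.Functional using (updateAt)
open import Data.Product using (∃; ∃-syntax; _×_; _,_; proj₁; proj₂)
open import Data.Sum using (_⊎_; inj₁; inj₂; reduce)
open import Function using (_∘_)
open import Relation.Binary.PropositionalEquality
open import Relation.Nullary using (¬_; Dec; yes; no; contradiction)
open import Relation.Nullary.Decidable using (_×-dec_; ¬?; from-yes)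

-- Elementary number theory

prime⇒2≤ : ∀ {p} → Prime p → 2 ≤ p
prime⇒2≤ pr = nonTrivial⇒n>1 _ {{prime⇒nonTrivial pr}}

n≤2^n : ∀ n → n ≤ 2 ^ n
n≤2^n zero    = z≤n
n≤2^n (suc n) = +-mono-≤ (m^n>0 2 n) (≤-trans (n≤2^n n) (m≤m+n (2 ^ n) 0))

^≤2^* : ∀ n k → n ^ k ≤ 2 ^ (n * k)
^≤2^* n k = ≤-trans (^-monoˡ-≤ k (n≤2^n n)) (≤-reflexive (^-*-assoc 2 n k))

∃-prime-factor : ∀ {n} → 2 ≤ n → ∃[ p ] Prime p × p ∣ n
∃-prime-factor {suc zero} (s≤s ())
∃-prime-factor {suc (suc n)} _ with factorise (suc (suc n))
... | record { factors = []     ; isFactorisation = () }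
... | record { factors = p ∷ ps ; isFactorisation = n≡ ; factorsPrime = pr ∷ _ } =
      p , pr , subst (p ∣_) (sym n≡) (m∣m*n (product ps))

∣⇒pos : ∀ {d n} → 1 ≤ n → d ∣ n → 1 ≤ d
∣⇒pos {zero}  1≤n 0∣n = contradiction (0∣⇒≡0 0∣n) (≢-sym (<⇒≢ 1≤n))
∣⇒pos {suc d} _   _   = s≤s z≤n

^∣-cancelˡ : ∀ {s X w} k → Prime s → s ∤ X → s ^ k ∣ X * w → s ^ k ∣ w
^∣-cancelˡ             zero    pr s∤X _    = 1∣ _
^∣-cancelˡ {s} {X} {w} (suc k) pr s∤X s^k∣ with euclidsLemma X w pr (∣-trans (m∣m*n (s ^ k)) s^k∣)
... | inj₁ s∣X              = contradiction s∣X s∤X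
... | inj₂ (divides u refl) =
  subst (s ^ suc k ∣_) (*-comm s u) (*-monoʳ-∣ s (^∣-cancelˡ k pr s∤X (*-cancelʳ-∣ s {{prime⇒nonZero pr}} s^k∣′)))
  where
    s^k∣′ : s ^ k * s ∣ X * u * s
    s^k∣′ = subst₂ _∣_ (*-comm s (s ^ k)) (sym (*-assoc X u s)) s^k∣

prime∤^ : ∀ {s q} m → Prime s → s ∤ q → s ∤ q ^ m
prime∤^         zero    pr s∤q s∣1 = contradiction (subst Prime (∣1⇒≡1 s∣1) pr) ¬prime[1]
prime∤^ {q = q} (suc m) pr s∤q s∣ with euclidsLemma q (q ^ m) pr s∣
... | inj₁ s∣q  = s∤q s∣q
... | inj₂ s∣qᵐ = prime∤^ m pr s∤q s∣qᵐ

prime∣prime⇒≡ : ∀ {r p} → Prime r → Prime p → r ∣ p → r ≡ p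
prime∣prime⇒≡ {r} {p} pr pp r∣p with r ≟ p
... | yes r≡p = r≡p
... | no  r≢p = contradiction (composite-≢ r {{prime⇒nonTrivial pr}} {{prime⇒nonZero pp}} r≢p r∣p)
                             (prime⇒¬composite pp)

remove-powers : ∀ {q} → 2 ≤ q → ∀ v → 1 ≤ v → ∃[ m ] ∃[ u ] v ≡ q ^ m * u × q ∤ u × 1 ≤ u
remove-powers {q} 2≤q v = go v (<-wellFounded v)
  where
    go : ∀ v → Acc _<_ v → 1 ≤ v → ∃[ m ] ∃[ u ] v ≡ q ^ m * u × q ∤ u × 1 ≤ u
    go v (acc rec) 1≤v with q ∣? v
    ... | no  q∤v                     = 0 , v , sym (*-identityˡ v) , q∤v , 1≤v
    ... | yes (divides zero    refl)  = contradiction 1≤v λ ()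
    ... | yes (divides (suc u) refl)  =
      let m , u′ , u≡ , q∤u′ , 1≤u′ = go (suc u) (rec (m<m*n (suc u) q 2≤q)) (s≤s z≤n)
      in  suc m , u′ , v≡ m u′ u≡ , q∤u′ , 1≤u′
      where
        v≡ : ∀ m u′ → suc u ≡ q ^ m * u′ → suc u * q ≡ q ^ suc m * u′
        v≡ m u′ u≡ = trans (*-comm (suc u) q) (trans (cong (q *_) u≡) (sym (*-assoc q (q ^ m) u′)))

record Decomposition (q v : ℕ) : Set where
  field
    m g w r : ℕ
    v≡      : v ≡ q ^ m * (g * w)
    g∣q     : g ∣ q
    1≤g     : 1 ≤ g
    1≤w     : 1 ≤ w
    r-prime : Prime r
    r∣q     : r ∣ q
    r∤w     : r ∤ w

-- Strip the powers of q from v, then split off g = gcd(u, q) from the rest u: since u/g and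
-- q/g > 1 are coprime, any prime factor r of q/g misses w = u/g.
decompose : ∀ {q} → 2 ≤ q → ∀ v → 1 ≤ v → Decomposition q v
decompose {q} 2≤q v 1≤v =
  let m , u , v≡ , q∤u , 1≤u = remove-powers 2≤q v 1≤v in split m u v≡ q∤u 1≤u
  where
    split : ∀ m u → v ≡ q ^ m * u → q ∤ u → 1 ≤ u → Decomposition q v
    split m u v≡ q∤u 1≤u = record
      { m = m ; g = g ; w = u / g ; r = r
      ; v≡ = trans v≡ (cong (q ^ m *_) (sym (m*[n/m]≡n g∣u)))
      ; g∣q = g∣q ; 1≤g = 1≤g ; 1≤w = ∣⇒pos 1≤u (m/n∣m g∣u)
      ; r-prime = r-prime ; r∣q = ∣-trans r∣h (m/n∣m g∣q) ; r∤w = r∤w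
      }
      where
        g = gcd u q
        g∣u = gcd[m,n]∣m u q
        g∣q = gcd[m,n]∣n u q
        1≤g = ∣⇒pos 1≤u g∣u
        instance
          _ : NonZero g
          _ = >-nonZero 1≤g
        h = q / g
        h≢1 : h ≢ 1
        h≢1 h≡1 = q∤u (subst (_∣ u) (trans (sym (*-identityʳ g)) (trans (cong (g *_) (sym h≡1)) (m*[n/m]≡n g∣q))) g∣u)
        2≤h : 2 ≤ h
        2≤h = ≤∧≢⇒< (∣⇒pos (≤-trans (s≤s z≤n) 2≤q) (m/n∣m g∣q)) (≢-sym h≢1)
        r-factor = ∃-prime-factor 2≤h
        r = proj₁ r-factor
        r-prime = proj₁ (proj₂ r-factor)
        r∣h = proj₂ (proj₂ r-factor)
        r∤w : r ∤ u / g
        r∤w r∣w = contradiction (coprime-/gcd u q (r∣w , r∣h)) (>⇒≢ (nonTrivial⇒n>1 r {{prime⇒nonTrivial r-prime}}))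

primeOtherThan? : ∀ r p → Dec (Prime p × p ≢ r)
primeOtherThan? r p = prime? p ×-dec ¬? (p ≟ r)

primesBelowExcept : ℕ → ℕ → List ℕ
primesBelowExcept r n = filter (primeOtherThan? r) (upTo n)

module _ {r n p : ℕ} where

  ∈-primesBelowExcept⁺ : p < n → Prime p → p ≢ r → p ∈ primesBelowExcept r n
  ∈-primesBelowExcept⁺ p<n pr p≢r = ∈-filter⁺ (primeOtherThan? r) (∈-upTo⁺ p<n) (pr , p≢r)

  ∈-primesBelowExcept⁻ : p ∈ primesBelowExcept r n → p < n × Prime p × p ≢ r
  ∈-primesBelowExcept⁻ p∈ =
    let p∈upTo , pr , p≢r = ∈-filter⁻ (primeOtherThan? r) {xs = upTo n} p∈
    in  ∈-upTo⁻ p∈upTo , pr , p≢r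

primesBelowExcept-unique : ∀ r n → Unique (primesBelowExcept r n)
primesBelowExcept-unique r n = filter⁺ (primeOtherThan? r) (upTo⁺ n)

primesBelowExcept-prime : ∀ r n → All Prime (primesBelowExcept r n)
primesBelowExcept-prime r n = All.tabulate λ p∈ → proj₁ (proj₂ (∈-primesBelowExcept⁻ {r} {n} p∈))

length-primesBelowExcept : ∀ r n → length (primesBelowExcept r n) ≤ n
length-primesBelowExcept r n =
  subst (length (primesBelowExcept r n) ≤_) (length-upTo n) (length-filter (primeOtherThan? r) (upTo n))

-- Products of prime powers

prodPow-pos : ∀ F α → All Prime F → 1 ≤ prodPow F α
prodPow-pos []      α []        = ≤-refl
prodPow-pos (p ∷ F) α (pr ∷ ps) =
  *-mono-≤ {1} {p ^ α zero} (m^n>0 p {{prime⇒nonZero pr}} (α zero)) (prodPow-pos F (α ∘ suc) ps)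

prodPow-zero : ∀ F → prodPow F (λ _ → 0) ≡ 1
prodPow-zero []      = refl
prodPow-zero (p ∷ F) = trans (*-identityˡ _) (prodPow-zero F)

prodPow-updateAt-suc : ∀ F α i → prodPow F (updateAt α i suc) ≡ lookup F i * prodPow F α
prodPow-updateAt-suc (p ∷ F) α zero    = *-assoc p (p ^ α zero) _
prodPow-updateAt-suc (p ∷ F) α (suc i) = begin
  p ^ α zero * prodPow F (updateAt (α ∘ suc) i suc)   ≡⟨ cong (p ^ α zero *_) (prodPow-updateAt-suc F (α ∘ suc) i) ⟩
  p ^ α zero * (lookup F i * prodPow F (α ∘ suc))     ≡⟨ x∙yz≈y∙xz (p ^ α zero) (lookup F i) _ ⟩
  lookup F i * (p ^ α zero * prodPow F (α ∘ suc))     ∎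
  where
    open ≡-Reasoning
    open import Algebra.Properties.CommutativeSemigroup *-commutativeSemigroup using (x∙yz≈y∙xz)

product≡prodPow : ∀ F fs → All (_∈ F) fs → ∃[ α ] product fs ≡ prodPow F α
product≡prodPow F []       []          = (λ _ → 0) , sym (prodPow-zero F)
product≡prodPow F (f ∷ fs) (f∈F ∷ fs⊆F) =
  let α , fs≡ = product≡prodPow F fs fs⊆F
  in  updateAt α (index f∈F) suc ,
      trans (cong₂ _*_ (lookup-index f∈F) fs≡) (sym (prodPow-updateAt-suc F α (index f∈F)))

prodPow-factors : ∀ F w → 1 ≤ w → (∀ {p} → Prime p → p ∣ w → p ∈ F) → ∃[ α ] w ≡ prodPow F α
prodPow-factors F w 1≤w factors∈F =
  let α , fs≡ = product≡prodPow F factors (All.tabulate λ f∈fs →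
                  factors∈F (All.lookup factorsPrime f∈fs) (subst (_ ∣_) (sym isFactorisation) (∈⇒∣product f∈fs)))
  in  α , trans isFactorisation fs≡
  where open PrimeFactorisation (factorise w {{>-nonZero 1≤w}})

2^≤prodPow : ∀ F α → All Prime F → ∀ i → 2 ^ α i ≤ prodPow F α
2^≤prodPow (p ∷ F) α (pr ∷ ps) zero    = ≤-trans (^-monoˡ-≤ (α zero) (prime⇒2≤ pr))
  (m≤m*n (p ^ α zero) (prodPow F (α ∘ suc)) {{>-nonZero (prodPow-pos F (α ∘ suc) ps)}})
2^≤prodPow (p ∷ F) α (pr ∷ ps) (suc i) = ≤-trans (2^≤prodPow F (α ∘ suc) ps i)
  (m≤n*m _ (p ^ α zero) {{>-nonZero (m^n>0 p {{prime⇒nonZero pr}} (α zero))}})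

prodPow≤ : ∀ {X K} F α → 1 ≤ X → All (_≤ X) F → (∀ i → α i ≤ K) → prodPow F α ≤ (X ^ K) ^ length F
prodPow≤         []      α 1≤X []          _    = ≤-refl
prodPow≤ {X} {K} (p ∷ F) α 1≤X (p≤X ∷ F≤X) α≤K =
  *-mono-≤ (≤-trans (^-monoˡ-≤ (α zero) p≤X) (^-monoʳ-≤ X {{>-nonZero 1≤X}} (α≤K zero)))
           (prodPow≤ F (α ∘ suc) 1≤X F≤X (α≤K ∘ suc))

large-exponent : ∀ {X K} F α → 1 ≤ X → All (_≤ X) F → (X ^ K) ^ length F < prodPow F α → ∃[ i ] K ≤ α i
large-exponent {K = K} F α 1≤X F≤X big with any? (λ i → K ≤? α i)
... | yes found = found
... | no  none  = contradiction (prodPow≤ F α 1≤X F≤X λ i → <⇒≤ (≰⇒> λ K≤αi → none (i , K≤αi))) (<⇒≱ big)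

-- Rationals

-p≤∣p∣ : ∀ p → ℚ.- p ℚ.≤ ℚ.∣ p ∣
-p≤∣p∣ p with ℚP.∣p∣≡p∨∣p∣≡-p p
... | inj₁ ∣p∣≡p  = ℚP.≤-trans (ℚP.neg-antimono-≤ (ℚP.∣p∣≡p⇒0≤p ∣p∣≡p)) (ℚP.0≤∣p∣ p)
... | inj₂ ∣p∣≡-p = ℚP.≤-reflexive (sym ∣p∣≡-p)

∣p-q∣<r⇒q<r+p : ∀ p q r → ℚ.∣ p ℚ.- q ∣ ℚ.< r → q ℚ.< r ℚ.+ p
∣p-q∣<r⇒q<r+p p q r close =
  subst (ℚ._< r ℚ.+ p) (-[p-q]+p≡q p q) (ℚP.+-monoˡ-< p (ℚP.≤-<-trans (-p≤∣p∣ (p ℚ.- q)) close))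
  where
    open Algebra.Properties.AbelianGroup ℚP.+-0-abelianGroup using (⁻¹-anti-homo‿-)
    -[p-q]+p≡q : ∀ p q → ℚ.- (p ℚ.- q) ℚ.+ p ≡ q
    -[p-q]+p≡q p q = begin
      ℚ.- (p ℚ.- q) ℚ.+ p  ≡⟨ cong (ℚ._+ p) (⁻¹-anti-homo‿- p q) ⟩
      q ℚ.- p ℚ.+ p        ≡⟨ ℚP.+-assoc q (ℚ.- p) p ⟩
      q ℚ.+ (ℚ.- p ℚ.+ p)  ≡⟨ cong (q ℚ.+_) (ℚP.+-inverseˡ p) ⟩
      q ℚ.+ ℚ.0ℚ           ≡⟨ ℚP.+-identityʳ q ⟩
      q                    ∎
      where open ≡-Reasoning

0<1/suc : ∀ n → ℚ.0ℚ ℚ.< (+ 1) ℚ./ suc n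
0<1/suc n = ℚP.toℚᵘ-cancel-< (ℚᵘP.<-respʳ-≃ (ℚᵘP.≃-sym (ℚP.toℚᵘ-fromℚᵘ (mkℚᵘ (+ 1) n))) (*<* (+<+ (s≤s z≤n))))

1/q<1/2q+c/l⇒l<2qc : ∀ q′ c l → let q = suc q′ in
  frac 1 q ℚ.< (+ 1) ℚ./ (q + q) ℚ.+ frac c (suc l) → suc l < (q + q) * c
1/q<1/2q+c/l⇒l<2qc q′ c l bound = subst (L <_) (*-comm c D)
  (*-cancelʳ-< Q L (c * D) (+-cancelˡ-< (L * Q) (L * Q) (c * D * Q) in-ℕ))
  where
    Q = suc q′
    D = Q + Q
    L = suc l
    in-ℚᵘ : mkℚᵘ (+ 1) q′ ℚᵘ.< mkℚᵘ (+ 1) (q′ + Q) ℚᵘ.+ mkℚᵘ (+ c) l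
    in-ℚᵘ = ℚᵘP.<-respˡ-≃ (ℚP.toℚᵘ-fromℚᵘ (mkℚᵘ (+ 1) q′))
              (ℚᵘP.<-respʳ-≃ (ℚᵘP.≃-trans (ℚP.toℚᵘ-homo-+ ((+ 1) ℚ./ D) (frac c L))
                                 (ℚᵘP.+-cong (ℚP.toℚᵘ-fromℚᵘ (mkℚᵘ (+ 1) (q′ + Q))) (ℚP.toℚᵘ-fromℚᵘ (mkℚᵘ (+ c) l))))
                (ℚP.toℚᵘ-mono-< bound))
    in-ℤ : + 1 ℤ.* + (D * L) ℤ.< (+ 1 ℤ.* + L ℤ.+ + c ℤ.* + D) ℤ.* + Q
    in-ℤ with in-ℚᵘ
    ... | *<* lt = lt
    -- The bound 1/q < 1/(2q) + c/l with denominators cleared is l·2q < (l + 2q·c)·q.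
    in-ℕ : L * Q + L * Q < L * Q + c * D * Q
    in-ℕ = subst₂ _<_ (2q*l≡ l q′) ([l+c*2q]*q≡ l c q′) (ℤP.drop‿+<+ (subst₂ ℤ._<_ lhs rhs in-ℤ))
      where
        lhs : + 1 ℤ.* + (D * L) ≡ + (D * L)
        lhs = ℤP.*-identityˡ (+ (D * L))
        rhs : (+ 1 ℤ.* + L ℤ.+ + c ℤ.* + D) ℤ.* + Q ≡ + ((L + c * D) * Q)
        rhs = begin
          (+ 1 ℤ.* + L ℤ.+ + c ℤ.* + D) ℤ.* + Q ≡⟨ cong₂ (λ x y → (x ℤ.+ y) ℤ.* + Q) (sym (ℤP.*-identityˡ (+ L))) (ℤP.pos-* c D) ⟨
          (+ L ℤ.+ + (c * D)) ℤ.* + Q          ≡⟨ cong (ℤ._* + Q) (ℤP.pos-+ L (c * D)) ⟨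
          + (L + c * D) ℤ.* + Q                ≡⟨ ℤP.pos-* (L + c * D) Q ⟨
          + ((L + c * D) * Q)                  ∎
          where open ≡-Reasoning
        2q*l≡ : ∀ l q′ → (suc q′ + suc q′) * suc l ≡ suc l * suc q′ + suc l * suc q′
        2q*l≡ = solve-∀
        [l+c*2q]*q≡ : ∀ l c q′ → (suc l + c * (suc q′ + suc q′)) * suc q′ ≡ suc l * suc q′ + c * (suc q′ + suc q′) * suc q′
        [l+c*2q]*q≡ = solve-∀


∣c/l-1/q∣<1/2q⇒l<2qc : ∀ q′ c l → 1 ≤ l → let q = suc q′ in
  ℚ.∣ frac c l ℚ.- frac 1 q ∣ ℚ.< (+ 1) ℚ./ (q + q) → l < (q + q) * c
∣c/l-1/q∣<1/2q⇒l<2qc q′ c (suc l) _ close =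
  1/q<1/2q+c/l⇒l<2qc q′ c l (∣p-q∣<r⇒q<r+p (frac c (suc l)) (frac 1 (suc q′)) ((+ 1) ℚ./ (suc q′ + suc q′)) close)

-- Digits and the Erdős–Sloane map

iter-suc : ∀ (f : ℕ → ℕ) k x → iter f (suc k) x ≡ iter f k (f x)
iter-suc f zero    x = refl
iter-suc f (suc k) x = cong f (iter-suc f k x)

digitFactor : ℕ → ℕ
digitFactor zero    = 1
digitFactor (suc d) = suc d

prodNonzero-∷ : ∀ d ds → prodNonzero (d ∷ ds) ≡ digitFactor d * prodNonzero ds
prodNonzero-∷ zero    ds = sym (*-identityˡ (prodNonzero ds))
prodNonzero-∷ (suc d) ds = refl

prodNonzero-pos : ∀ ds → 1 ≤ prodNonzero ds
prodNonzero-pos []           = ≤-refl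
prodNonzero-pos (zero  ∷ ds) = prodNonzero-pos ds
prodNonzero-pos (suc d ∷ ds) = *-mono-≤ {1} {suc d} (s≤s z≤n) (prodNonzero-pos ds)

^countOcc∣prodNonzero : ∀ {d} → 1 ≤ d → ∀ ds → d ^ countOcc d ds ∣ prodNonzero ds
^countOcc∣prodNonzero {suc d} _ [] = ∣-refl
^countOcc∣prodNonzero {suc d} 1≤d (x ∷ ds) with suc d ≟ x
... | yes refl = *-monoʳ-∣ (suc d) (^countOcc∣prodNonzero 1≤d ds)
... | no  _    = ∣-trans (^countOcc∣prodNonzero 1≤d ds)
                   (subst (prodNonzero ds ∣_) (sym (prodNonzero-∷ x ds)) (n∣m*n (digitFactor x)))

prime∣prodNonzero⇒< : ∀ {p n} ds → Prime p → All (_< n) ds → p ∣ prodNonzero ds → p < n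
prime∣prodNonzero⇒< []           pr []           p∣1 = contradiction (subst Prime (∣1⇒≡1 p∣1) pr) ¬prime[1]
prime∣prodNonzero⇒< (zero  ∷ ds) pr (_   ∷ ds<n) p∣  = prime∣prodNonzero⇒< ds pr ds<n p∣
prime∣prodNonzero⇒< (suc d ∷ ds) pr (d<n ∷ ds<n) p∣ with euclidsLemma (suc d) (prodNonzero ds) pr p∣
... | inj₁ p∣d  = ≤-<-trans (∣⇒≤ p∣d) d<n
... | inj₂ p∣ds = prime∣prodNonzero⇒< ds pr ds<n p∣ds

module Base (c : ℕ) where

  b : ℕ
  b = 2 + c

  1<b : 1 < b
  1<b = s≤s (s≤s z≤n)

  /b-< : ∀ {n} → 1 ≤ n → n / b < n
  /b-< {suc m} _ = m/n<m (suc m) b 1<b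

  digitsAux-fuel : ∀ f g n → n ≤ f → n ≤ g → digitsAux b f n ≡ digitsAux b g n
  digitsAux-fuel zero    zero    zero    _         _         = refl
  digitsAux-fuel zero    (suc g) zero    _         _         = refl
  digitsAux-fuel (suc f) zero    zero    _         _         = refl
  digitsAux-fuel (suc f) (suc g) zero    _         _         = refl
  digitsAux-fuel (suc f) (suc g) (suc m) (s≤s m≤f) (s≤s m≤g) =
    cong (suc m % b ∷_) (digitsAux-fuel f g (suc m / b) (≤-trans q≤m m≤f) (≤-trans q≤m m≤g))
    where q≤m = <⇒≤pred (/b-< {suc m} (s≤s z≤n))

  digits-suc : ∀ m → digits b (suc m) ≡ suc m % b ∷ digits b (suc m / b)
  digits-suc m = cong (suc m % b ∷_)
    (digitsAux-fuel m (suc m / b) (suc m / b) (<⇒≤pred (/b-< {suc m} (s≤s z≤n))) ≤-refl)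

  digits-< : ∀ n → All (_< b) (digits b n)
  digits-< n = go n n
    where
      go : ∀ f n → All (_< b) (digitsAux b f n)
      go zero    n       = []
      go (suc f) zero    = []
      go (suc f) (suc m) = m%n<n (suc m) b ∷ go f (suc m / b)

  <b^#dig : ∀ n → n < b ^ #dig b n
  <b^#dig n = go n (<-wellFounded n)
    where
      go : ∀ n → Acc _<_ n → n < b ^ #dig b n
      go zero    _         = s≤s z≤n
      go (suc m) (acc rec) = subst (λ ds → suc m < b ^ length ds) (sym (digits-suc m)) (begin-strict
        suc m             ≡⟨ m≡m%n+[m/n]*n (suc m) b ⟩
        suc m % b + q * b <⟨ +-monoˡ-< (q * b) (m%n<n (suc m) b) ⟩
        b + q * b         ≡⟨ *-comm (suc q) b ⟩
        b * suc q         ≤⟨ *-monoʳ-≤ b (go q (rec (/b-< {suc m} (s≤s z≤n)))) ⟩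
        b * b ^ #dig b q  ∎)
        where
          open ≤-Reasoning
          q = suc m / b

  b^≤⇒<#dig : ∀ {M n} → b ^ M ≤ n → M < #dig b n
  b^≤⇒<#dig {M} {n} b^M≤n = ≰⇒> λ #dig≤M → <⇒≱ (<b^#dig n) (≤-trans (^-monoʳ-≤ b #dig≤M) b^M≤n)

  #dig-pos : ∀ {n} → 1 ≤ n → 1 ≤ #dig b n
  #dig-pos {suc m} _ = subst (λ ds → 1 ≤ length ds) (sym (digits-suc m)) (s≤s z≤n)

  S*-prime-factor-< : ∀ {p n} → Prime p → p ∣ S* b n → p < b
  S*-prime-factor-< {n = n} pr = prime∣prodNonzero⇒< (digits b n) pr (digits-< n)

  S*-pos : ∀ n → 1 ≤ S* b n
  S*-pos n = prodNonzero-pos (digits b n)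

  S*-unfold : ∀ n → 1 ≤ n → S* b n ≡ digitFactor (n % b) * S* b (n / b)
  S*-unfold (suc m) _ = trans (cong prodNonzero (digits-suc m)) (prodNonzero-∷ (suc m % b) (digits b (suc m / b)))

  S*-fixes : ∀ n → 1 ≤ n → n < b → S* b n ≡ n
  S*-fixes n 1≤n n<b = begin
    S* b n                         ≡⟨ S*-unfold n 1≤n ⟩
    digitFactor (n % b) * S* b (n / b) ≡⟨ cong₂ (λ d q → digitFactor d * S* b q) (m<n⇒m%n≡m n<b) (m<n⇒m/n≡0 n<b) ⟩
    digitFactor n * 1              ≡⟨ *-identityʳ _ ⟩
    digitFactor n                  ≡⟨ digitFactor-pos 1≤n ⟩
    n                              ∎
    where
      open ≡-Reasoning
      digitFactor-pos : ∀ {n} → 1 ≤ n → digitFactor n ≡ n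
      digitFactor-pos {suc n} _ = refl

  S*-b* : ∀ n → 1 ≤ n → S* b (b * n) ≡ S* b n
  S*-b* n 1≤n = begin
    S* b (b * n)                               ≡⟨ S*-unfold (b * n) (*-mono-≤ {1} {b} (s≤s z≤n) 1≤n) ⟩
    digitFactor ((b * n) % b) * S* b ((b * n) / b) ≡⟨ cong₂ (λ d q → digitFactor d * S* b q) b*n%b≡0 b*n/b≡n ⟩
    1 * S* b n                                 ≡⟨ *-identityˡ _ ⟩
    S* b n                                     ∎
    where
      open ≡-Reasoning
      b*n%b≡0 = trans (cong (_% b) (*-comm b n)) (m*n%n≡0 n b)
      b*n/b≡n = trans (cong (_/ b) (*-comm b n)) (m*n/n≡m n b)

  S*-b^* : ∀ m n → 1 ≤ n → S* b (b ^ m * n) ≡ S* b n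
  S*-b^* zero    n _   = cong (S* b) (*-identityˡ n)
  S*-b^* (suc m) n 1≤n = begin
    S* b (b * b ^ m * n)   ≡⟨ cong (S* b) (*-assoc b (b ^ m) n) ⟩
    S* b (b * (b ^ m * n)) ≡⟨ S*-b* (b ^ m * n) (*-mono-≤ {1} {b ^ m} (m^n>0 b m) 1≤n) ⟩
    S* b (b ^ m * n)       ≡⟨ S*-b^* m n 1≤n ⟩
    S* b n                 ∎
    where open ≡-Reasoning

  S*-step : ∀ n → 1 ≤ n / b → S* b (n / b) ≤ n / b → S* b n < n
  S*-step n 1≤q Sq≤q = begin-strict
    S* b n                         ≡⟨ S*-unfold n (≤-trans 1≤q (m/n≤m n b)) ⟩
    digitFactor (n % b) * S* b q   ≤⟨ *-mono-≤ (digitFactor-< (m%n<n n b)) Sq≤q ⟩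
    suc c * q                      <⟨ *-monoˡ-< q {{>-nonZero 1≤q}} (n<1+n (suc c)) ⟩
    b * q                          ≡⟨ *-comm b q ⟩
    q * b                          ≤⟨ m/n*n≤m n b ⟩
    n                              ∎
    where
      open ≤-Reasoning
      q = n / b
      digitFactor-< : ∀ {d} → d < b → digitFactor d ≤ suc c
      digitFactor-< {zero}  _         = s≤s z≤n
      digitFactor-< {suc d} (s≤s d<b) = d<b

  S*-≤ : ∀ n → 1 ≤ n → S* b n ≤ n
  S*-≤ n = go n (<-wellFounded n)
    where
      go : ∀ n → Acc _<_ n → 1 ≤ n → S* b n ≤ n
      go n (acc rec) 1≤n with b ≤? n
      ... | no  n≱b = ≤-reflexive (S*-fixes n 1≤n (≰⇒> n≱b))
      ... | yes b≤n = <⇒≤ (S*-step n 1≤q (go (n / b) (rec (/b-< 1≤n)) 1≤q))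
        where 1≤q = m≥n⇒m/n>0 b≤n

  S*-< : ∀ {n} → b ≤ n → S* b n < n
  S*-< {n} b≤n = S*-step n 1≤q (S*-≤ (n / b) 1≤q)
    where 1≤q = m≥n⇒m/n>0 b≤n

  iter-S*-pos : ∀ k n → 1 ≤ n → 1 ≤ iter (S* b) k n
  iter-S*-pos zero    n 1≤n = 1≤n
  iter-S*-pos (suc k) n _   = S*-pos (iter (S* b) k n)

  iter-S*-≤ : ∀ k n → 1 ≤ n → iter (S* b) k n ≤ n
  iter-S*-≤ zero    n _   = ≤-refl
  iter-S*-≤ (suc k) n 1≤n = ≤-trans (S*-≤ _ (iter-S*-pos k n 1≤n)) (iter-S*-≤ k n 1≤n)

  digit-periodic : ∀ {x} → 1 ≤ x → x < b → Periodic (S* b) x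
  digit-periodic 1≤x x<b = 1 , ≤-refl , S*-fixes _ 1≤x x<b

  ≥b⇒¬periodic : ∀ {x} → b ≤ x → ¬ Periodic (S* b) x
  ≥b⇒¬periodic     b≤x (zero  , () , _)
  ≥b⇒¬periodic {x} b≤x (suc k , _  , returns) = <-irrefl returns (begin-strict
    iter (S* b) (suc k) x  ≡⟨ iter-suc (S* b) k x ⟩
    iter (S* b) k (S* b x) ≤⟨ iter-S*-≤ k (S* b x) (S*-pos x) ⟩
    S* b x                 <⟨ S*-< b≤x ⟩
    x                      ∎)
    where open ≤-Reasoning

  persistence-exists : ∀ n → 1 ≤ n → ∃[ k ] PersistenceIs b n k
  persistence-exists n = go n (<-wellFounded n)
    where
      go : ∀ n → Acc _<_ n → 1 ≤ n → ∃[ k ] PersistenceIs b n k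
      go n (acc rec) 1≤n with b ≤? n
      ... | no  n≱b = 0 , digit-periodic 1≤n (≰⇒> n≱b) , λ _ ()
      ... | yes b≤n with go (S* b n) (rec (S*-< b≤n)) (S*-pos n)
      ...   | k , periodic , earlier =
              suc k , subst (Periodic (S* b)) (sym (iter-suc (S* b) k n)) periodic , not-yet
        where
          not-yet : ∀ j → j < suc k → ¬ Periodic (S* b) (iter (S* b) j n)
          not-yet zero    _         = ≥b⇒¬periodic b≤n
          not-yet (suc j) (s≤s j<k) =
            subst (¬_ ∘ Periodic (S* b)) (sym (iter-suc (S* b) j n)) (earlier j j<k)

  persistence-≥ : ∀ {n k t} → PersistenceIs b n k →
                  (∀ j → j < t → b ≤ iter (S* b) j n) → t ≤ k
  persistence-≥ {k = k} (periodic , _) large = ≮⇒≥ λ k<t → ≥b⇒¬periodic (large k k<t) periodic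

  large-persistence-from-family :
    (Q : ℕ → ℕ → Set) →
    (∀ K → ∃[ K′ ] ∀ x → Q K′ x → b ≤ x × Q K (S* b x)) →
    (∀ K → ∃[ x ] 1 ≤ x × Q K x) →
    ArbitrarilyLargePersistence b
  large-persistence-from-family Q closed inhabited t _ =
    let K , large       = stays-large t
        x , 1≤x , x∈Q   = inhabited K
        k , persistence = persistence-exists x 1≤x
    in  x , k , 1≤x , persistence , persistence-≥ persistence (large x x∈Q)
    where
      stays-large : ∀ t → ∃[ K ] ∀ x → Q K x → ∀ j → j < t → b ≤ iter (S* b) j x
      stays-large zero    = 0 , λ _ _ _ ()
      stays-large (suc t) with stays-large t
      ... | K , large with closed K
      ...   | K′ , step = K′ , λ where
                x x∈Q zero    _         → proj₁ (step x x∈Q)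
                x x∈Q (suc j) (s≤s j<t) → subst (b ≤_) (sym (iter-suc (S* b) j x))
                                            (large (S* b x) (proj₂ (step x x∈Q)) j j<t)

-- Equidistribution hypotheses

EquidistributedBeyond : ℕ → ℚ → List ℕ → ℕ → ℕ → Set
EquidistributedBeyond q ε F a N =
  (α : Fin (length F) → ℕ) → ∃[ i ] N ≤ α i → Equidistributed q ε (a * prodPow F α)

conjectureA⇒single-prime : ConjectureA → ∀ {q p} → 1 < q → Prime p → MissesPrimeOf q (p ∷ []) →
  ∀ a → 1 ≤ a → ∀ ε → ℚ.0ℚ ℚ.< ε → ∃ (EquidistributedBeyond q ε (p ∷ []) a)
conjectureA⇒single-prime conjA {q} {p} 1<q pr misses a 1≤a ε 0<ε =
  let n₀ , eventually = conjA q 1<q (p ∷ []) (pr ∷ []) misses a 1≤a (λ k → a * p ^ k) (*-identityʳ a)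
                          (λ k → p , here refl , step k) ε 0<ε
  in  n₀ , λ { α (zero , n₀≤α₀) → subst (Equidistributed q ε) (cong (a *_) (sym (*-identityʳ (p ^ α zero))))
                                         (eventually (α zero) n₀≤α₀) }
  where
    step : ∀ k → a * p ^ suc k ≡ a * p ^ k * p
    step k = trans (cong (a *_) (*-comm p (p ^ k))) (sym (*-assoc a (p ^ k) p))

bound-of-decidable : ∀ {D : Set} {P : ℕ → Set} → Dec D → (D → ∃ P) → ∃[ n ] (D → P n)
bound-of-decidable (yes d) bound = let n , p = bound d in n , λ _ → p
bound-of-decidable (no ¬d) _     = 0 , λ d → contradiction d ¬d

uniform-bound : ∀ {D : ℕ → Set} (P : ℕ → ℕ → Set) → (∀ {x m n} → m ≤ n → P x m → P x n) →
                (∀ x → Dec (D x)) → ∀ R → (∀ x → x < R → D x → ∃ (P x)) →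
                ∃[ n ] ∀ x → x < R → D x → P x n
uniform-bound P mono D? zero    _      = 0 , λ _ ()
uniform-bound P mono D? (suc R) bounds
  with uniform-bound P mono D? R (λ x x<R → bounds x (m<n⇒m<1+n x<R))
     | bound-of-decidable (D? R) (bounds R (n<1+n R))
... | n , below | m , at = n + m , combined
  where
    combined : ∀ x → x < suc R → _ → P x (n + m)
    combined x x<1+R dx with m<1+n⇒m<n∨m≡n x<1+R
    ... | inj₁ x<R  = mono (m≤m+n n m) (below x x<R dx)
    ... | inj₂ refl = mono (m≤n+m m n) (at dx)

module LargePersistence (c : ℕ) (1≤c : 1 ≤ c) where
  open Base c

  ε : ℚ
  ε = (+ 1) ℚ./ (b + b)

  Beyond : ℕ → ℕ → ℕ → Set
  Beyond r = EquidistributedBeyond b ε (primesBelowExcept r b)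

  Beyond-mono : ∀ r a {M N} → M ≤ N → Beyond r a M → Beyond r a N
  Beyond-mono r a M≤N equi α (i , N≤αᵢ) = equi α (i , ≤-trans M≤N N≤αᵢ)

  Hypothesis : Set
  Hypothesis = ∀ r → Prime r → r ∣ b → ∀ a → 1 ≤ a → a ≤ b → ∃ (Beyond r a)

  UniformHypothesis : ℕ → Set
  UniformHypothesis N = ∀ r → Prime r → r ∣ b → ∀ a → 1 ≤ a → a ≤ b → Beyond r a N

  uniformly : Hypothesis → ∃ UniformHypothesis
  uniformly hyp =
    let N , uniform = uniform-bound (λ r N → ∀ a → a < suc b → 1 ≤ a → Beyond r a N)
                        (λ {r} M≤N below a a<1+b 1≤a → Beyond-mono r a M≤N (below a a<1+b 1≤a))
                        (λ r → prime? r ×-dec r ∣? b) (suc b)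
                        (λ r _ (pr , r∣b) → for-divisor r pr r∣b)
    in  N , λ r pr r∣b a 1≤a a≤b → uniform r (s≤s (∣⇒≤ r∣b)) (pr , r∣b) a (s≤s a≤b) 1≤a
    where
      for-divisor : ∀ r → Prime r → r ∣ b → ∃[ N ] ∀ a → a < suc b → 1 ≤ a → Beyond r a N
      for-divisor r pr r∣b = uniform-bound (Beyond r) (λ {a} → Beyond-mono r a) (1 ≤?_) (suc b)
                               (λ a a<1+b 1≤a → hyp r pr r∣b a 1≤a (≤-pred a<1+b))

  s-factor : ∃[ p ] Prime p × p ∣ suc c
  s-factor = ∃-prime-factor (s≤s 1≤c)

  s : ℕ
  s = proj₁ s-factor

  s-prime : Prime s
  s-prime = proj₁ (proj₂ s-factor)

  s<b : s < b
  s<b = s≤s (∣⇒≤ (proj₂ (proj₂ s-factor)))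

  s∤b : s ∤ b
  s∤b s∣b = contradiction (subst Prime (∣1⇒≡1 s∣1) s-prime) ¬prime[1]
    where s∣1 = ∣m+n∣m⇒∣n (subst (s ∣_) (+-comm 1 (suc c)) s∣b) (proj₂ (proj₂ s-factor))

  record Member (K x : ℕ) : Set where
    field
      r a m   : ℕ
      r-prime : Prime r
      r∣b     : r ∣ b
      1≤a     : 1 ≤ a
      a≤b     : a ≤ b
      α       : Fin (length (primesBelowExcept r b)) → ℕ
      x≡      : x ≡ b ^ m * (a * prodPow (primesBelowExcept r b) α)
      i       : Fin (length (primesBelowExcept r b))
      K≤αᵢ    : K ≤ α i

  member-exists : ∀ K → ∃[ x ] 1 ≤ x × Member K x
  member-exists K = _ , 1≤x , record
    { r = r ; a = 1 ; m = 0 ; r-prime = r-prime ; r∣b = r∣b ; 1≤a = ≤-refl ; a≤b = s≤s z≤n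
    ; α = λ _ → K ; x≡ = refl ; i = index s∈F ; K≤αᵢ = ≤-refl }
    where
      r-factor = ∃-prime-factor {b} (s≤s (s≤s z≤n))
      r = proj₁ r-factor
      r-prime = proj₁ (proj₂ r-factor)
      r∣b = proj₂ (proj₂ r-factor)
      s∈F : s ∈ primesBelowExcept r b
      s∈F = ∈-primesBelowExcept⁺ s<b s-prime λ s≡r → s∤b (subst (_∣ b) (sym s≡r) r∣b)
      1≤x : 1 ≤ b ^ 0 * (1 * prodPow (primesBelowExcept r b) (λ _ → K))
      1≤x = subst (1 ≤_) (sym (trans (*-identityˡ _) (*-identityˡ _)))
              (prodPow-pos _ _ (primesBelowExcept-prime r b))

  S*-member : ∀ K y → b * (K * b) < #d s b y → Member K (S* b y)
  S*-member K y many = record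
    { r = r ; a = g ; m = m ; r-prime = r-prime ; r∣b = r∣q ; 1≤a = 1≤g ; a≤b = ∣⇒≤ g∣q
    ; α = proj₁ w-factored ; x≡ = trans v≡ (cong (λ w → b ^ m * (g * w)) (proj₂ w-factored))
    ; i = proj₁ large ; K≤αᵢ = proj₂ large }
    where
      open Decomposition (decompose (s≤s (s≤s z≤n)) (S* b y) (S*-pos y))
      F = primesBelowExcept r b
      w∣S* : w ∣ S* b y
      w∣S* = subst (w ∣_) (sym v≡) (∣n⇒∣m*n (b ^ m) (n∣m*n g))
      w-factored : ∃[ α ] w ≡ prodPow F α
      w-factored = prodPow-factors F w 1≤w λ pr p∣w →
        ∈-primesBelowExcept⁺ {r} {b} (S*-prime-factor-< {n = y} pr (∣-trans p∣w w∣S*)) pr λ { refl → r∤w p∣w }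
      s∤bᵐg : s ∤ b ^ m * g
      s∤bᵐg s∣ = prime∤^ (suc m) s-prime s∤b
                   (∣-trans s∣ (subst (b ^ m * g ∣_) (*-comm (b ^ m) b) (*-monoʳ-∣ (b ^ m) g∣q)))
      s^∣w : s ^ #d s b y ∣ w
      s^∣w = ^∣-cancelˡ (#d s b y) s-prime s∤bᵐg
               (subst (s ^ #d s b y ∣_) (trans v≡ (sym (*-assoc (b ^ m) g w)))
                 (^countOcc∣prodNonzero (<⇒≤ (prime⇒2≤ s-prime)) (digits b y)))
      large : ∃[ j ] K ≤ proj₁ w-factored j
      large = large-exponent F (proj₁ w-factored) (s≤s z≤n)
                (All.tabulate λ p∈ → <⇒≤ (proj₁ (∈-primesBelowExcept⁻ p∈))) (begin-strict
        (b ^ K) ^ length F       ≤⟨ ^-monoʳ-≤ (b ^ K) {{>-nonZero (m^n>0 b K)}} (length-primesBelowExcept r b) ⟩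
        (b ^ K) ^ b              ≡⟨ ^-*-assoc b K b ⟩
        b ^ (K * b)              ≤⟨ ^≤2^* b (K * b) ⟩
        2 ^ (b * (K * b))        <⟨ ^-monoʳ-< 2 (s≤s (s≤s z≤n)) many ⟩
        2 ^ #d s b y             ≤⟨ ^-monoˡ-≤ (#d s b y) (prime⇒2≤ s-prime) ⟩
        s ^ #d s b y             ≤⟨ ∣⇒≤ {{>-nonZero 1≤w}} s^∣w ⟩
        w                        ≡⟨ proj₂ w-factored ⟩
        prodPow F (proj₁ w-factored) ∎)
        where open ≤-Reasoning

  frequent-s : ∀ {y} → 1 ≤ y → Equidistributed b ε y → #dig b y < (b + b) * #d s b y
  frequent-s {y} 1≤y equi = ∣c/l-1/q∣<1/2q⇒l<2qc (suc c) (#d s b y) (#dig b y) (#dig-pos 1≤y)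
    (subst (λ d → ℚ.∣ frac (#d d b y) (#dig b y) ℚ.- frac 1 b ∣ ℚ.< ε) (toℕ-fromℕ< s<b) (equi (fromℕ< s<b)))

  closure : ∃ UniformHypothesis → ∀ K → ∃[ K′ ] ∀ x → Member K′ x → b ≤ x × Member K (S* b x)
  -- An exponent ≥ N₀ + b·M makes y equidistributed and y ≥ b^M, so y has more than M digits,
  -- more than C of them equal to s.
  closure (N₀ , uniform) K = N₀ + b * M , step
    where
      C = b * (K * b)
      M = (b + b) * suc C
      step : ∀ x → Member (N₀ + b * M) x → b ≤ x × Member K (S* b x)
      step x x∈ = b≤x , subst (Member K) (sym S*x≡S*y) (S*-member K y C<#d)
        where
          open Member x∈
          F = primesBelowExcept r b
          y = a * prodPow F α
          b^M≤y : b ^ M ≤ y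
          b^M≤y = begin
            b ^ M        ≤⟨ ^≤2^* b M ⟩
            2 ^ (b * M)  ≤⟨ ^-monoʳ-≤ 2 (≤-trans (m≤n+m (b * M) N₀) K≤αᵢ) ⟩
            2 ^ α i      ≤⟨ 2^≤prodPow F α (primesBelowExcept-prime r b) i ⟩
            prodPow F α  ≤⟨ m≤n*m _ a {{>-nonZero 1≤a}} ⟩
            y            ∎
            where open ≤-Reasoning
          1≤y : 1 ≤ y
          1≤y = ≤-trans (m^n>0 b M) b^M≤y
          b≤x : b ≤ x
          b≤x = begin
            b         ≡⟨ *-identityʳ b ⟨
            b ^ 1     ≤⟨ ^-monoʳ-≤ b {1} {M} (s≤s z≤n) ⟩
            b ^ M     ≤⟨ b^M≤y ⟩
            y         ≤⟨ m≤n*m y (b ^ m) {{>-nonZero (m^n>0 b m)}} ⟩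
            b ^ m * y ≡⟨ x≡ ⟨
            x         ∎
            where open ≤-Reasoning
          S*x≡S*y : S* b x ≡ S* b y
          S*x≡S*y = trans (cong (S* b) x≡) (S*-b^* m y 1≤y)
          equidistributed : Equidistributed b ε y
          equidistributed = uniform r r-prime r∣b a 1≤a a≤b α (i , ≤-trans (m≤m+n N₀ (b * M)) K≤αᵢ)
          C<#d : C < #d s b y
          C<#d = <-trans (n<1+n C) (*-cancelˡ-< (b + b) (suc C) (#d s b y)
                   (<-trans (b^≤⇒<#dig b^M≤y) (frequent-s 1≤y equidistributed)))

  from-hypothesis : Hypothesis → ArbitrarilyLargePersistence b
  from-hypothesis hyp = large-persistence-from-family Member (closure (uniformly hyp)) member-exists

prime[3] : Prime 3
prime[3] = from-yes (prime? 3)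

-- primesBelowExcept 3 3 and primesBelowExcept 2 4 compute to 2 ∷ [] and 3 ∷ [].
conjectureA⇒hypothesis₃ : ConjectureA → LargePersistence.Hypothesis 1 ≤-refl
conjectureA⇒hypothesis₃ conjA r pr r∣3 a 1≤a _ with prime∣prime⇒≡ pr prime[3] r∣3
... | refl = conjectureA⇒single-prime conjA (s≤s (s≤s z≤n)) prime[2]
               (3 , prime[3] , ∣-refl , λ { (here ()) ; (there ()) }) a 1≤a _ (0<1/suc 5)

conjectureA⇒hypothesis₄ : ConjectureA → LargePersistence.Hypothesis 2 (s≤s z≤n)
conjectureA⇒hypothesis₄ conjA r pr r∣4 a 1≤a _
  with prime∣prime⇒≡ pr prime[2] (reduce (euclidsLemma 2 2 pr r∣4))
... | refl = conjectureA⇒single-prime conjA (s≤s (s≤s z≤n)) prime[3]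
               (2 , prime[2] , divides 2 refl , λ { (here ()) ; (there ()) }) a 1≤a _ (0<1/suc 7)

conjectureB⇒hypothesis : ConjectureB → ∀ c (1≤c : 1 ≤ c) → LargePersistence.Hypothesis c 1≤c
conjectureB⇒hypothesis conjB c 1≤c r pr r∣b a 1≤a _ =
  conjB b 1<b F (primesBelowExcept-unique r b) (primesBelowExcept-prime r b) (r , pr , r∣b , r∉F) a 1≤a
        ((+ 1) ℚ./ (b + b)) (0<1/suc (suc c + b))
  where
    open Base c
    F = primesBelowExcept r b
    r∉F : r ∉ F
    r∉F r∈F = proj₂ (proj₂ (∈-primesBelowExcept⁻ {r} {b} r∈F)) refl

theorem5 : (ConjectureA → (b : ℕ) → (b ≡ 3 ⊎ b ≡ 4) → ArbitrarilyLargePersistence b)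
         × (ConjectureB → (b : ℕ) → 5 ≤ b → ArbitrarilyLargePersistence b)
theorem5 = base-3-or-4 , base-≥5
  where
    base-3-or-4 : ConjectureA → (b : ℕ) → (b ≡ 3 ⊎ b ≡ 4) → ArbitrarilyLargePersistence b
    base-3-or-4 conjA .3 (inj₁ refl) = LargePersistence.from-hypothesis 1 ≤-refl (conjectureA⇒hypothesis₃ conjA)
    base-3-or-4 conjA .4 (inj₂ refl) = LargePersistence.from-hypothesis 2 (s≤s z≤n) (conjectureA⇒hypothesis₄ conjA)
    base-≥5 : ConjectureB → (b : ℕ) → 5 ≤ b → ArbitrarilyLargePersistence b
    base-≥5 conjB (suc (suc c)) (s≤s (s≤s 3≤c)) =
      LargePersistence.from-hypothesis c 1≤c (conjectureB⇒hypothesis conjB c 1≤c)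
      where 1≤c = ≤-trans (s≤s z≤n) 3≤c
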